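{- Assume the setting described in the context. For every $\alpha:X\multimap\overline{F_\tau}X$ in $\mathcal{K}l(T)$ we have $\underline{\alpha}^{\divideontimes}\le(\underline{\alpha^{\bigstar}})^{\divideontimes}$.
   Context: Let $\mathsf{C}$ be a category with binary coproducts and $(T,\mu,\eta)$ a monad on $\mathsf{C}$. In the Kleisli category $\mathcal{K}l(T)$ (objects of $\mathsf{C}$; morphisms $X\multimap Y$ are $\mathsf{C}$-morphisms $X\to TY$; composition $g\cdot f=\mu_Z\circ Tg\circ f$; identity $1_X=\eta_X$) write $f^\sharp=\eta_Y\circ f$ for $f:X\to Y$ in $\mathsf{C}$; coproducts of $\mathcal{K}l(T)$ are those of $\mathsf{C}$, with coprojections $\iota^1,\iota^2$ and cotupling $[-,-]$. $\mathcal{K}l(T)$ is order-enriched (hom-sets are posets, composition monotone) and $T$ is an order saturation monad: for every $\alpha:X\multimap X$ there is $\alpha^{*}:X\multimap X$ with (a) $1\le\alpha^*$, (b) $\alpha\le\alpha^*$, (c) $\alpha^*\cdot\alpha^*\le\alpha^*$, (d) if $\beta:X\multimap X$ satisfies $1\le\beta$, $\alpha\le\beta$, $\beta\cdot\beta\le\beta$ then $\alpha^*\le\beta$, (e) for all $f:X\to Y$ in $\mathsf{C}$, $\beta:Y\multimap Y$ and $\Box\in\{\le,\ge\}$: $f^\sharp\cdot\alpha\mathrel{\Box}\beta\cdot f^\sharp$ implies $f^\sharp\cdot\alpha^*\mathrel{\Box}\beta^*\cdot f^\sharp$. A functor $S$ on $\mathsf{C}$ lifts to $\overline{S}$ on $\mathcal{K}l(T)$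 if $\overline{S}X=SX$ and $\overline{S}(f^\sharp)=(Sf)^\sharp$; if $(\overline{S},m,e)$ is a monad on $\mathcal{K}l(T)$ then $TS$ is a monad on $\mathsf{C}$ whose Kleisli category is $\mathcal{K}l(\overline{S})$, with hom-sets $Hom_{\mathcal{K}l(T)}(X,\overline{S}Y)$ ordered as in $\mathcal{K}l(T)$. Standing assumptions: $\mathcal{K}l(T)$ has zero morphisms $0_{X,Y}$ (with $f\cdot 0=0=0\cdot g$). $F:\mathsf{C}\to\mathsf{C}$ lifts to $\overline{F}$, so $F_\tau=F+\mathcal{I}d$ lifts to $\overline{F_\tau}=\overline{F}+\mathcal{I}d$, which is a monad $(\overline{F_\tau},m',e')$ on $\mathcal{K}l(T)$ with $e'_X=\iota^2:X\multimap\overline{F}X+X$ and $m'_X=[\iota^1,id]\cdot(\overline{F}([0,id])+id):\overline{F}(\overline{F}X+X)+(\overline{F}X+X)\multimap\overline{F}X+X$. $F$ admits all free $F$-algebras, giving the free monad $F^*$ on $\mathsf{C}$; it lifts to $\overline{F}^*$ on $\mathcal{K}l(T)$ and $(\overline{F}^*,m,e)$ is the free monad over $\overline{F}$ in $\mathcal{K}l(T)$ with universal natural transformation $\nu:\overline{F}\Rightarrow\overline{F}^*$. For both $(\overline{S},m,e)=(\overline{F_\tau},m',e')$ and $(\overline{S},m,e)=(\overline{F}^*,m,e)$, $\overline{S}$ is locally monotonic and $m_X\cdot\overline{S}[(m_X\cdot\overline{S}\alpha)^*\cdot e_X]=(m_X\cdot\overline{S}\alpha)^*$ for all $\alpha:X\multimap\overline{S}X$.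 For $\alpha:X\multimap\overline{F_\tau}X$ put $\alpha^{\bigstar}=(m'_X\cdot\overline{F_\tau}\alpha)^*\cdot e'_X$, and for $\beta:Y\multimap\overline{F}^*Y$ put $\beta^{\divideontimes}=(m_Y\cdot\overline{F}^*\beta)^*\cdot e_Y$ (these are saturation operators making $TF_\tau$ and $TF^*$ order saturation monads, with hom-set orders inherited from $\mathcal{K}l(T)$). For $\alpha:X\multimap\overline{F_\tau}X$ let $\underline{\alpha}=[\nu_X,e_X]\cdot\alpha:X\multimap\overline{F}^*X$. -}

module Defs where

open import Level using (Level; _⊔_; suc)
open import Relation.Binary.PropositionalEquality using (_≡_)
open import Relation.Binary.Structures using (IsPartialOrder)
open import Data.Product using (Σ; _×_)

record Category (o h : Level) : Set (suc (o ⊔ h)) where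
  infixr 9 _∘_
  field
    Obj   : Set o
    Hom   : Obj → Obj → Set h
    id    : ∀ {X} → Hom X X
    _∘_   : ∀ {X Y Z} → Hom Y Z → Hom X Y → Hom X Z
    idˡ   : ∀ {X Y} (f : Hom X Y) → id ∘ f ≡ f
    idʳ   : ∀ {X Y} (f : Hom X Y) → f ∘ id ≡ f
    assoc : ∀ {W X Y Z} (h : Hom Y Z) (g : Hom X Y) (f : Hom W X) →
            (h ∘ g) ∘ f ≡ h ∘ (g ∘ f)

module _ {o h : Level} (C : Category o h) where
  open Category C

  record Functor : Set (o ⊔ h) where
    field
      F₀    : Obj → Obj
      F₁    : ∀ {X Y} → Hom X Y → Hom (F₀ X) (F₀ Y)
      F-id  : ∀ {X} → F₁ (id {X}) ≡ id
      F-∘   : ∀ {X Y Z} (g : Hom Y Z) (f : Hom X Y) → F₁ (g ∘ f) ≡ F₁ g ∘ F₁ f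

  record Monad : Set (o ⊔ h) where
    field
      T     : Functor
    open Functor T public
    field
      η     : ∀ X → Hom X (F₀ X)
      μ     : ∀ X → Hom (F₀ (F₀ X)) (F₀ X)
      η-nat : ∀ {X Y} (f : Hom X Y) → F₁ f ∘ η X ≡ η Y ∘ f
      μ-nat : ∀ {X Y} (f : Hom X Y) → F₁ f ∘ μ X ≡ μ Y ∘ F₁ (F₁ f)
      μ-assoc : ∀ X → μ X ∘ F₁ (μ X) ≡ μ X ∘ μ (F₀ X)
      μ-η     : ∀ X → μ X ∘ η (F₀ X) ≡ id
      μ-Fη    : ∀ X → μ X ∘ F₁ (η X) ≡ id

  record BinaryCoproducts : Set (o ⊔ h) where
    infixr 6 _+_
    field
      _+_   : Obj → Obj → Obj
      ι₁    : ∀ {X Y} → Hom X (X + Y)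
      ι₂    : ∀ {X Y} → Hom Y (X + Y)
      [_,_] : ∀ {X Y Z} → Hom X Z → Hom Y Z → Hom (X + Y) Z
      inject₁ : ∀ {X Y Z} (f : Hom X Z) (g : Hom Y Z) → [ f , g ] ∘ ι₁ ≡ f
      inject₂ : ∀ {X Y Z} (f : Hom X Z) (g : Hom Y Z) → [ f , g ] ∘ ι₂ ≡ g
      unique  : ∀ {X Y Z} (f : Hom X Z) (g : Hom Y Z) (u : Hom (X + Y) Z) →
                u ∘ ι₁ ≡ f → u ∘ ι₂ ≡ g → u ≡ [ f , g ]

module Kleisli {o h : Level} (C : Category o h) (M : Monad C) where
  open Category C
  open Monad M

  KHom : Obj → Obj → Set h
  KHom X Y = Hom X (F₀ Y)

  infixr 9 _·_
  _·_ : ∀ {X Y Z} → KHom Y Z → KHom X Y → KHom X Z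
  _·_ {Z = Z} g f = μ Z ∘ (F₁ g ∘ f)

  1K : ∀ {X} → KHom X X
  1K {X} = η X

  _♯ : ∀ {X Y} → Hom X Y → KHom X Y
  _♯ {Y = Y} f = η Y ∘ f

record Base (o h ℓ : Level) : Set (suc (o ⊔ h ⊔ ℓ)) where
  field
    C   : Category o h
    M   : Monad C
    coprod : BinaryCoproducts C
  open Category C
  open Kleisli C M
  field
    _≤_   : ∀ {X Y} → KHom X Y → KHom X Y → Set ℓ
    ≤-po  : ∀ {X Y} → IsPartialOrder _≡_ (_≤_ {X} {Y})
    ·-mono : ∀ {X Y Z} {g g′ : KHom Y Z} {f f′ : KHom X Y} →
             g ≤ g′ → f ≤ f′ → (g · f) ≤ (g′ · f′)
    _*    : ∀ {X} → KHom X X → KHom X X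
    sat-a : ∀ {X} (α : KHom X X) → 1K ≤ (α *)
    sat-b : ∀ {X} (α : KHom X X) → α ≤ (α *)
    sat-c : ∀ {X} (α : KHom X X) → ((α *) · (α *)) ≤ (α *)
    sat-d : ∀ {X} (α β : KHom X X) →
            1K ≤ β → α ≤ β → (β · β) ≤ β → (α *) ≤ β
    sat-e≤ : ∀ {X Y} (f : Hom X Y) (α : KHom X X) (β : KHom Y Y) →
             ((f ♯) · α) ≤ (β · (f ♯)) → ((f ♯) · (α *)) ≤ ((β *) · (f ♯))
    sat-e≥ : ∀ {X Y} (f : Hom X Y) (α : KHom X X) (β : KHom Y Y) →
             (β · (f ♯)) ≤ ((f ♯) · α) → ((β *) · (f ♯)) ≤ ((f ♯) · (α *))
    0K    : ∀ {X Y} → KHom X Y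
    zeroˡ : ∀ {X Y Z} (f : KHom Y Z) → f · 0K {X} {Y} ≡ 0K
    zeroʳ : ∀ {X Y Z} (g : KHom X Y) → 0K {Y} {Z} · g ≡ 0K

module Setup {o h ℓ : Level} (B : Base o h ℓ) where
  open Base B public
  open Category C public
  open Monad M public using (F₀; F₁; η; μ)
  open Kleisli C M public
  open BinaryCoproducts coprod public

  ι¹ : ∀ {X Y} → KHom X (X + Y)
  ι¹ = ι₁ ♯
  ι² : ∀ {X Y} → KHom Y (X + Y)
  ι² = ι₂ ♯

  _⊕_ : ∀ {X Y X′ Y′} → KHom X X′ → KHom Y Y′ → KHom (X + Y) (X′ + Y′)
  f ⊕ g = [ ι¹ · f , ι² · g ]

  record Lifting (S : Functor C) : Set (o ⊔ h) where
    open Functor S using () renaming (F₀ to S₀; F₁ to S₁)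
    field
      map    : ∀ {X Y} → KHom X Y → KHom (S₀ X) (S₀ Y)
      map-id : ∀ {X} → map (1K {X}) ≡ 1K
      map-·  : ∀ {X Y Z} (g : KHom Y Z) (f : KHom X Y) → map (g · f) ≡ map g · map f
      lifts  : ∀ {X Y} (f : Hom X Y) → map (f ♯) ≡ (S₁ f) ♯

  record IsKlMonad (S : Obj → Obj) (map : ∀ {X Y} → KHom X Y → KHom (S X) (S Y))
                   (m : ∀ X → KHom (S (S X)) (S X)) (e : ∀ X → KHom X (S X))
                   : Set (o ⊔ h) where
    field
      map-id  : ∀ {X} → map (1K {X}) ≡ 1K
      map-·   : ∀ {X Y Z} (g : KHom Y Z) (f : KHom X Y) → map (g · f) ≡ map g · map f
      e-nat   : ∀ {X Y} (f : KHom X Y) → map f · e X ≡ e Y · f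
      m-nat   : ∀ {X Y} (f : KHom X Y) → map f · m X ≡ m Y · map (map f)
      m-assoc : ∀ X → m X · map (m X) ≡ m X · m (S X)
      m-e     : ∀ X → m X · e (S X) ≡ 1K
      m-map-e : ∀ X → m X · map (e X) ≡ 1K

  record KlMonad : Set (o ⊔ h) where
    field
      S   : Obj → Obj
      map : ∀ {X Y} → KHom X Y → KHom (S X) (S Y)
      m   : ∀ X → KHom (S (S X)) (S X)
      e   : ∀ X → KHom X (S X)
      isMonad : IsKlMonad S map m e

  record IsMonadMorphism (A B′ : KlMonad) (θ : ∀ X → KHom (KlMonad.S A X) (KlMonad.S B′ X))
                         : Set (o ⊔ h) where
    private
      module A = KlMonad A
      module B = KlMonad B′
    field
      θ-nat : ∀ {X Y} (f : KHom X Y) → θ Y · A.map f ≡ B.map f · θ X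
      θ-e   : ∀ X → θ X · A.e X ≡ B.e X
      θ-m   : ∀ X → θ X · A.m X ≡ B.m X · (B.map (θ X) · θ (A.S X))

  module Tau (F : Functor C) (F̄ : Lifting F) where
    open Functor F using () renaming (F₀ to F0)
    open Lifting F̄ using () renaming (map to F̄₁)

    Fτ₀ : Obj → Obj
    Fτ₀ X = F0 X + X

    F̄τ₁ : ∀ {X Y} → KHom X Y → KHom (Fτ₀ X) (Fτ₀ Y)
    F̄τ₁ α = F̄₁ α ⊕ α

    e′ : ∀ X → KHom X (Fτ₀ X)
    e′ X = ι²

    m′ : ∀ X → KHom (Fτ₀ (Fτ₀ X)) (Fτ₀ X)
    m′ X = [ ι¹ , 1K ] · (F̄₁ [ 0K , 1K ] ⊕ 1K)

  record Setting : Set (suc (o ⊔ h ⊔ ℓ)) where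
    field
      F  : Functor C
      F̄  : Lifting F
    open Tau F F̄ public
    open Functor F using () renaming (F₀ to F0)
    open Lifting F̄ using () renaming (map to F̄₁)
    field
      Fτ-monad : IsKlMonad Fτ₀ F̄τ₁ m′ e′
      -- the free monad F* (on C) and its lifting F̄*, the free monad over F̄ in Kl(T)
      F*  : Functor C
      F̄*  : Lifting F*
    open Functor F* using () renaming (F₀ to F*₀)
    open Lifting F̄* using () renaming (map to F̄*₁)
    field
      m   : ∀ X → KHom (F*₀ (F*₀ X)) (F*₀ X)
      e   : ∀ X → KHom X (F*₀ X)
      F*-monad : IsKlMonad F*₀ F̄*₁ m e
      ν     : ∀ X → KHom (F0 X) (F*₀ X)
      ν-nat : ∀ {X Y} (f : KHom X Y) → ν Y · F̄₁ f ≡ F̄*₁ f · ν X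
    F̄*-KlMonad : KlMonad
    F̄*-KlMonad = record { S = F*₀ ; map = F̄*₁ ; m = m ; e = e ; isMonad = F*-monad }
    field
      free : (N : KlMonad) (σ : ∀ X → KHom (F0 X) (KlMonad.S N X)) →
             (∀ {X Y} (f : KHom X Y) → σ Y · F̄₁ f ≡ KlMonad.map N f · σ X) →
             Σ (∀ X → KHom (F*₀ X) (KlMonad.S N X)) (λ θ →
               IsMonadMorphism F̄*-KlMonad N θ × (∀ X → θ X · ν X ≡ σ X) ×
               ((θ′ : ∀ X → KHom (F*₀ X) (KlMonad.S N X)) →
                 IsMonadMorphism F̄*-KlMonad N θ′ → (∀ X → θ′ X · ν X ≡ σ X) →
                 ∀ X → θ′ X ≡ θ X))
      Fτ-mono : ∀ {X Y} {α β : KHom X Y} → α ≤ β → F̄τ₁ α ≤ F̄τ₁ β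
      F*-mono : ∀ {X Y} {α β : KHom X Y} → α ≤ β → F̄*₁ α ≤ F̄*₁ β
      Fτ-eq : ∀ {X} (α : KHom X (Fτ₀ X)) →
              m′ X · F̄τ₁ (((m′ X · F̄τ₁ α) *) · e′ X) ≡ (m′ X · F̄τ₁ α) *
      F*-eq : ∀ {X} (α : KHom X (F*₀ X)) →
              m X · F̄*₁ (((m X · F̄*₁ α) *) · e X) ≡ (m X · F̄*₁ α) *

    _★ : ∀ {X} → KHom X (Fτ₀ X) → KHom X (Fτ₀ X)
    _★ {X} α = ((m′ X · F̄τ₁ α) *) · e′ X

    _⋇ : ∀ {Y} → KHom Y (F*₀ Y) → KHom Y (F*₀ Y)
    _⋇ {Y} β = ((m Y · F̄*₁ β) *) · e Y

    ⌊_⌋ : ∀ {X} → KHom X (Fτ₀ X) → KHom X (F*₀ X)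
    ⌊_⌋ {X} α = [ ν X , e X ] · α

module Submission where

open import Level using (Level)
open import Defs
open import Relation.Binary.PropositionalEquality
open import Relation.Binary.Structures using (IsPartialOrder; IsPreorder)

-- For a monad (S, m, e) on Kl(T), the saturation (m · S̄ α)* · e extends α
-- (since α = (m · S̄ α) · e ≤ (m · S̄ α)* · e) and is monotone in α when S̄ is.
-- Taking S = F_τ gives α ≤ α★; taking S = F* and composing with ⌊_⌋ gives the claim.

module KleisliLaws {o h : Level} (C : Category o h) (M : Monad C) where
  open Category C
  open Monad M
  open Kleisli C M

  ·-assoc : ∀ {W X Y Z} (k : KHom Y Z) (g : KHom X Y) (f : KHom W X) →
            (k · g) · f ≡ k · (g · f)
  ·-assoc {Y = Y} {Z = Z} k g f = begin
      μ Z ∘ (F₁ (μ Z ∘ (F₁ k ∘ g)) ∘ f)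
    ≡⟨ cong (λ u → μ Z ∘ (u ∘ f)) (trans (F-∘ _ _) (cong (F₁ (μ Z) ∘_) (F-∘ _ _))) ⟩
      μ Z ∘ ((F₁ (μ Z) ∘ (F₁ (F₁ k) ∘ F₁ g)) ∘ f)
    ≡⟨ cong (μ Z ∘_) (assoc _ _ _) ⟩
      μ Z ∘ (F₁ (μ Z) ∘ ((F₁ (F₁ k) ∘ F₁ g) ∘ f))
    ≡⟨ sym (assoc _ _ _) ⟩
      (μ Z ∘ F₁ (μ Z)) ∘ ((F₁ (F₁ k) ∘ F₁ g) ∘ f)
    ≡⟨ cong (_∘ ((F₁ (F₁ k) ∘ F₁ g) ∘ f)) (μ-assoc Z) ⟩
      (μ Z ∘ μ (F₀ Z)) ∘ ((F₁ (F₁ k) ∘ F₁ g) ∘ f)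
    ≡⟨ assoc _ _ _ ⟩
      μ Z ∘ (μ (F₀ Z) ∘ ((F₁ (F₁ k) ∘ F₁ g) ∘ f))
    ≡⟨ cong (μ Z ∘_) (trans (cong (μ (F₀ Z) ∘_) (assoc _ _ _)) (sym (assoc _ _ _))) ⟩
      μ Z ∘ ((μ (F₀ Z) ∘ F₁ (F₁ k)) ∘ (F₁ g ∘ f))
    ≡⟨ cong (λ u → μ Z ∘ (u ∘ (F₁ g ∘ f))) (sym (μ-nat k)) ⟩
      μ Z ∘ ((F₁ k ∘ μ Y) ∘ (F₁ g ∘ f))
    ≡⟨ cong (μ Z ∘_) (assoc _ _ _) ⟩
      μ Z ∘ (F₁ k ∘ (μ Y ∘ (F₁ g ∘ f)))
    ∎
    where open ≡-Reasoning

  ·-identityˡ : ∀ {X Y} (f : KHom X Y) → 1K · f ≡ f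
  ·-identityˡ {Y = Y} f = begin
      μ Y ∘ (F₁ (η Y) ∘ f) ≡⟨ sym (assoc _ _ _) ⟩
      (μ Y ∘ F₁ (η Y)) ∘ f ≡⟨ cong (_∘ f) (μ-Fη Y) ⟩
      id ∘ f               ≡⟨ idˡ f ⟩
      f                    ∎
    where open ≡-Reasoning

module Saturation {o h ℓ : Level} (B : Base o h ℓ) where
  open Setup B
  open KleisliLaws C M

  ≤-refl : ∀ {X Y} {f : KHom X Y} → f ≤ f
  ≤-refl = IsPreorder.reflexive (IsPartialOrder.isPreorder ≤-po) refl

  ≤-trans : ∀ {X Y} {f g k : KHom X Y} → f ≤ g → g ≤ k → f ≤ k
  ≤-trans = IsPreorder.trans (IsPartialOrder.isPreorder ≤-po)

  *-mono : ∀ {X} {α β : KHom X X} → α ≤ β → (α *) ≤ (β *)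
  *-mono {β = β} α≤β = sat-d _ _ (sat-a β) (≤-trans α≤β (sat-b β)) (sat-c β)

  module _ {S : Obj → Obj} {map : ∀ {X Y} → KHom X Y → KHom (S X) (S Y)}
           {m : ∀ X → KHom (S (S X)) (S X)} {e : ∀ X → KHom X (S X)} where

    saturate : ∀ {X} → KHom X (S X) → KHom X (S X)
    saturate {X} α = ((m X · map α) *) · e X

    ≤-saturate : IsKlMonad S map m e → ∀ {X} (α : KHom X (S X)) → α ≤ saturate α
    ≤-saturate isMonad {X} α =
      subst (_≤ saturate α) unfold (·-mono (sat-b (m X · map α)) ≤-refl)
      where
      open IsKlMonad isMonad
      unfold : (m X · map α) · e X ≡ α
      unfold = begin
        (m X · map α) · e X   ≡⟨ ·-assoc _ _ _ ⟩
        m X · (map α · e X)   ≡⟨ cong (m X ·_) (e-nat α) ⟩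
        m X · (e (S X) · α)   ≡⟨ sym (·-assoc _ _ _) ⟩
        (m X · e (S X)) · α   ≡⟨ cong (_· α) (m-e X) ⟩
        1K · α                ≡⟨ ·-identityˡ α ⟩
        α                     ∎
        where open ≡-Reasoning

    saturate-mono : (∀ {X Y} {f g : KHom X Y} → f ≤ g → map f ≤ map g) →
                    ∀ {X} {α β : KHom X (S X)} → α ≤ β → saturate α ≤ saturate β
    saturate-mono map-mono α≤β = ·-mono (*-mono (·-mono ≤-refl (map-mono α≤β))) ≤-refl

lemma3 : ∀ {o h ℓ : Level} (B : Base o h ℓ) (S : Setup.Setting B) →
    let open Setup B in
    let open Setting S in
    ∀ {X} (α : KHom X (Fτ₀ X)) → (⌊ α ⌋ ⋇) ≤ (⌊ α ★ ⌋ ⋇)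
lemma3 B S α =
  saturate-mono {m = m} {e = e} F*-mono (·-mono ≤-refl (≤-saturate Fτ-monad α))
  where
  open Setup B
  open Setting S
  open Saturation B
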